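{- Let $G$ be a graph that admits an open XOR-magic labeling, and let $A(G)$ be its adjacency matrix (an integer $0/1$ matrix). Then $\det(A(G))\equiv 0 \pmod 2$.
   Context: All graphs are simple. For a vertex $x$, $N(x)$ is the set of neighbours of $x$. An open XOR-magic labeling of a graph $G=(V,E)$ with $|V|=2^n$ is a bijection $\ell:V\to(\mathbb{Z}_2)^n$ such that $\sum_{y\in N(x)}\ell(y)$ equals the zero vector of $(\mathbb{Z}_2)^n$ for every $x\in V$. -}

module Defs where

open import Data.Nat using (ℕ; zero; suc; _^_)
open import Data.Bool using (Bool; true; false; if_then_else_; _xor_)
open import Data.Fin using (Fin; zero; suc; punchIn)
open import Data.Vec using (Vec; replicate; zipWith)
open import Data.Integer using (ℤ; +_; _+_; _*_; -_)
open import Data.Product using (_×_)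
open import Relation.Binary.PropositionalEquality using (_≡_)
open import Relation.Nullary using (¬_)
open import Function.Bundles using (_⤖_; Bijection)

record SimpleGraph (m : ℕ) : Set where
  field
    adj       : Fin m → Fin m → Bool
    symmetric : ∀ x y → adj x y ≡ adj y x
    loopless  : ∀ x → adj x x ≡ false
open SimpleGraph public

ℤ₂^ : ℕ → Set
ℤ₂^ n = Vec Bool n

zeroV : ∀ {n} → ℤ₂^ n
zeroV = replicate _ false

_⊕_ : ∀ {n} → ℤ₂^ n → ℤ₂^ n → ℤ₂^ n
_⊕_ = zipWith _xor_

sumV : ∀ {n m} → (Fin m → ℤ₂^ n) → ℤ₂^ n
sumV {m = zero}  f = zeroV
sumV {m = suc m} f = f zero ⊕ sumV (λ y → f (suc y))

neighbourSum : ∀ {m n} → SimpleGraph m → (Fin m → ℤ₂^ n) → Fin m → ℤ₂^ n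
neighbourSum G ℓ x = sumV (λ y → if adj G x y then ℓ y else zeroV)

record OpenXORMagicLabeling (n : ℕ) (G : SimpleGraph (2 ^ n)) : Set where
  field
    bij   : Fin (2 ^ n) ⤖ ℤ₂^ n
    magic : ∀ x → neighbourSum G (Bijection.to bij) x ≡ zeroV

Matrix : ℕ → Set
Matrix m = Fin m → Fin m → ℤ

minor : ∀ {m} → Matrix (suc m) → Fin (suc m) → Matrix m
minor A j r c = A (suc r) (punchIn j c)

sign : ∀ {m} → Fin m → ℤ
sign zero    = + 1
sign (suc j) = - sign j

sumℤ : ∀ {m} → (Fin m → ℤ) → ℤ
sumℤ {zero}  f = + 0
sumℤ {suc m} f = f zero + sumℤ (λ j → f (suc j))

det : ∀ {m} → Matrix m → ℤ
det {zero}  A = + 1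
det {suc m} A = sumℤ (λ j → sign j * (A zero j * det (minor A j)))

adjMatrix : ∀ {m} → SimpleGraph m → Matrix m
adjMatrix G x y = if adj G x y then + 1 else + 0

{-# OPTIONS --safe #-}
-- Reduced mod 2, det A(G) becomes the determinant of A(G) over GF(2) = (Bool, xor, ∧). Any
-- coordinate v of the labeling satisfies A(G) v = 0 by the magic condition, and v ≠ 0 because the
-- labeling is onto; so A(G) is singular over GF(2). Singularity follows, as usual, from the Laplace
-- expansion along an arbitrary row and the vanishing of determinants with two equal rows.
module Submission where

open import Defs
open import Data.Nat using (ℕ; _^_)
open import Data.Integer using (ℤ; +_)
open import Data.Integer.Divisibility using (_∣_)

open import Algebra.Bundles using (CommutativeRing; CommutativeMonoid)
open import Data.Nat using (zero; suc)
open import Data.Bool using (Bool; true; false; not; _∧_; _xor_; if_then_else_)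
open import Data.Bool.Properties
  using (xor-∧-commutativeRing; ∧-commutativeMonoid; ∧-comm; ∧-assoc; ∧-zeroʳ; xor-identityʳ; xor-same)
open import Data.Fin using (Fin; zero; suc; punchIn)
open import Data.Fin.Patterns using (0F; 1F)
open import Data.Fin.Properties using (_≟_; punchIn-injective; punchInᵢ≢i)
open import Data.Integer using (_+_; _*_; -_; _-_; ∣_∣)
open import Data.Integer.Properties using (*-identityˡ; +-identityˡ; neg-distribˡ-*; abs-*)
open import Data.Integer.Tactic.RingSolver using (solve-∀)
import Data.Nat.Divisibility as ℕ
open import Data.Product using (Σ-syntax; _×_; _,_; proj₁; proj₂)
open import Data.Vec using (lookup; _∷_; replicate)
open import Data.Vec.Properties using (lookup-zipWith; lookup-replicate)
open import Data.Vec.Functional using (Vector; tail; removeAt; updateAt; map) renaming (_∷_ to _◂_)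
open import Data.Vec.Functional.Properties using (updateAt-updates; updateAt-minimal)
open import Function using (_∘_; const)
open import Function.Bundles using (Bijection; mk⇔)
open import Relation.Binary.PropositionalEquality
open import Relation.Nullary using (does; contradiction)
open import Relation.Nullary.Decidable using (dec-true; dec-false; does-⇔)

open CommutativeRing xor-∧-commutativeRing using (semiring)
open import Algebra.Properties.Semiring.Sum semiring
  using (sum; sum-syntax; sum-cong-≗; sum-remove; sum-replicate-zero; ∑-comm; ∑-distrib-+;
         *-distribˡ-sum; *-distribʳ-sum)
open import Algebra.Properties.CommutativeSemigroup (CommutativeMonoid.commutativeSemigroup ∧-commutativeMonoid)
  using (x∙yz≈y∙xz; xy∙z≈xz∙y)
open import Algebra.Solver.CommutativeMonoid ∧-commutativeMonoid using (solve; _⊜_) renaming (_⊕_ to _·_)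

⟦_⟧ : Bool → ℤ
⟦ false ⟧ = + 0
⟦ true  ⟧ = + 1

infix 4 _≡₂_

record _≡₂_ (x : ℤ) (b : Bool) : Set where
  constructor by-quotient
  field
    quotient : ℤ
    equation : x ≡ ⟦ b ⟧ + quotient * + 2

⟦⟧-xor : ∀ a b → ⟦ a ⟧ + ⟦ b ⟧ ≡ ⟦ a xor b ⟧ + ⟦ a ∧ b ⟧ * + 2
⟦⟧-xor false false = refl
⟦⟧-xor false true  = refl
⟦⟧-xor true  false = refl
⟦⟧-xor true  true  = refl

⟦⟧-∧ : ∀ a b → ⟦ a ⟧ * ⟦ b ⟧ ≡ ⟦ a ∧ b ⟧
⟦⟧-∧ false b     = refl
⟦⟧-∧ true  false = refl
⟦⟧-∧ true  true  = refl

if-≡₂ : ∀ b → (if b then + 1 else + 0) ≡₂ b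
if-≡₂ false = by-quotient (+ 0) refl
if-≡₂ true  = by-quotient (+ 0) refl

+-≡₂ : ∀ {x y a b} → x ≡₂ a → y ≡₂ b → x + y ≡₂ a xor b
+-≡₂ {a = a} {b} (by-quotient q refl) (by-quotient p refl) = by-quotient (⟦ a ∧ b ⟧ + q + p) (begin
  (⟦ a ⟧ + q * + 2) + (⟦ b ⟧ + p * + 2)         ≡⟨ regroup ⟦ a ⟧ ⟦ b ⟧ q p ⟩
  (⟦ a ⟧ + ⟦ b ⟧) + (q + p) * + 2               ≡⟨ cong (_+ (q + p) * + 2) (⟦⟧-xor a b) ⟩
  ⟦ a xor b ⟧ + ⟦ a ∧ b ⟧ * + 2 + (q + p) * + 2 ≡⟨ collect ⟦ a xor b ⟧ ⟦ a ∧ b ⟧ q p ⟩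
  ⟦ a xor b ⟧ + (⟦ a ∧ b ⟧ + q + p) * + 2       ∎)
  where
  open ≡-Reasoning
  regroup : ∀ x y q p → (x + q * + 2) + (y + p * + 2) ≡ (x + y) + (q + p) * + 2
  regroup = solve-∀
  collect : ∀ x c q p → x + c * + 2 + (q + p) * + 2 ≡ x + (c + q + p) * + 2
  collect = solve-∀

*-≡₂ : ∀ {x y a b} → x ≡₂ a → y ≡₂ b → x * y ≡₂ a ∧ b
*-≡₂ {a = a} {b} (by-quotient q refl) (by-quotient p refl) = by-quotient r (begin
  (⟦ a ⟧ + q * + 2) * (⟦ b ⟧ + p * + 2) ≡⟨ expand ⟦ a ⟧ ⟦ b ⟧ q p ⟩
  ⟦ a ⟧ * ⟦ b ⟧ + r * + 2                ≡⟨ cong (_+ r * + 2) (⟦⟧-∧ a b) ⟩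
  ⟦ a ∧ b ⟧ + r * + 2                    ∎)
  where
  open ≡-Reasoning
  r : ℤ
  r = q * ⟦ b ⟧ + ⟦ a ⟧ * p + q * p * + 2
  expand : ∀ x y q p → (x + q * + 2) * (y + p * + 2) ≡ x * y + (q * y + x * p + q * p * + 2) * + 2
  expand = solve-∀

neg-≡₂ : ∀ {x a} → x ≡₂ a → - x ≡₂ a
neg-≡₂ {a = a} (by-quotient q refl) = by-quotient (- ⟦ a ⟧ - q) (negate ⟦ a ⟧ q)
  where
  negate : ∀ x q → - (x + q * + 2) ≡ x + (- x - q) * + 2
  negate = solve-∀

sign-≡₂ : ∀ {k x a} (j : Fin k) → x ≡₂ a → sign j * x ≡₂ a
sign-≡₂ {x = x} zero    x≡₂a = subst (_≡₂ _) (sym (*-identityˡ x)) x≡₂a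
sign-≡₂ {x = x} (suc j) x≡₂a = subst (_≡₂ _) (neg-distribˡ-* (sign j) x) (neg-≡₂ (sign-≡₂ j x≡₂a))

sumℤ-≡₂ : ∀ {k} {f : Fin k → ℤ} {g : Fin k → Bool} → (∀ j → f j ≡₂ g j) → sumℤ f ≡₂ sum g
sumℤ-≡₂ {zero}  _     = by-quotient (+ 0) refl
sumℤ-≡₂ {suc k} f≡₂g = +-≡₂ (f≡₂g zero) (sumℤ-≡₂ (f≡₂g ∘ suc))

≡₂-false⇒2∣ : ∀ {x} → x ≡₂ false → + 2 ∣ x
≡₂-false⇒2∣ (by-quotient q refl) =
  ℕ.divides ∣ q ∣ (trans (cong ∣_∣ (+-identityˡ (q * + 2))) (abs-* q (+ 2)))

sum-zero : ∀ {m} {f : Fin m → Bool} → (∀ j → f j ≡ false) → sum f ≡ false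
sum-zero {m} f≡false = trans (sum-cong-≗ f≡false) (sum-replicate-zero m)

sum-onlyAt : ∀ {m} {f : Fin m → Bool} i → (∀ t → t ≢ i → f t ≡ false) → sum f ≡ f i
sum-onlyAt {suc m} {f} i f≡false = begin
  sum f                         ≡⟨ sum-remove f ⟩
  f i xor sum (removeAt f i)    ≡⟨ cong (f i xor_) (sum-zero (λ c → f≡false (punchIn i c) (punchInᵢ≢i i c))) ⟩
  f i xor false                 ≡⟨ xor-identityʳ (f i) ⟩
  f i                           ∎
  where open ≡-Reasoning

∧∧-distrib-sum : ∀ {m} x y (f : Fin m → Bool) → x ∧ (y ∧ sum f) ≡ sum (λ j → x ∧ (y ∧ f j))
∧∧-distrib-sum x y f = trans (cong (x ∧_) (*-distribˡ-sum y f)) (*-distribˡ-sum x (λ j → y ∧ f j))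

∑∑-symmetric-hollow : ∀ {m} (f : Fin m → Fin m → Bool) → (∀ a b → f a b ≡ f b a) → (∀ a → f a a ≡ false) →
                      ∑[ a < m ] ∑[ b < m ] f a b ≡ false
∑∑-symmetric-hollow {zero}  f f-sym f-diag = refl
∑∑-symmetric-hollow {suc m} f f-sym f-diag = begin
  (f 0F 0F xor X) xor ∑[ a < m ] (f (suc a) 0F xor ∑[ b < m ] f (suc a) (suc b))
    ≡⟨ cong₂ (λ d s → (d xor X) xor s) (f-diag 0F)
             (∑-distrib-+ (λ a → f (suc a) 0F) (λ a → ∑[ b < m ] f (suc a) (suc b))) ⟩
  X xor (∑[ a < m ] f (suc a) 0F xor ∑[ a < m ] ∑[ b < m ] f (suc a) (suc b))
    ≡⟨ cong₂ (λ s t → X xor (s xor t)) (sum-cong-≗ (λ a → f-sym (suc a) 0F))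
             (∑∑-symmetric-hollow (λ a b → f (suc a) (suc b)) (λ a b → f-sym (suc a) (suc b)) (f-diag ∘ suc)) ⟩
  X xor (X xor false)
    ≡⟨ cong (X xor_) (xor-identityʳ X) ⟩
  X xor X
    ≡⟨ xor-same X ⟩
  false ∎
  where
  open ≡-Reasoning
  X : Bool
  X = ∑[ b < m ] f 0F (suc b)

infixl 6 _∖_

_∖_ : ∀ {m} → (Fin m → Bool) → Fin m → Fin m → Bool
(S ∖ j) c = S c ∧ not (does (c ≟ j))

∖-self : ∀ {m} (S : Fin m → Bool) j → (S ∖ j) j ≡ false
∖-self S j rewrite dec-true (j ≟ j) refl = ∧-zeroʳ (S j)

∖-comm : ∀ {m} (S : Fin m → Bool) a b → S ∖ a ∖ b ≗ S ∖ b ∖ a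
∖-comm S a b c = xy∙z≈xz∙y (S c) (not (does (c ≟ a))) (not (does (c ≟ b)))

removeAt-∖ : ∀ {m} (S : Fin (suc m) → Bool) j c → removeAt (S ∖ punchIn j c) j ≗ removeAt S j ∖ c
removeAt-∖ S j c c′ = cong (λ b → S (punchIn j c′) ∧ not b)
  (does-⇔ (mk⇔ (punchIn-injective j c′ c) (cong (punchIn j))) (punchIn j c′ ≟ punchIn j c) (c′ ≟ c))

removeAt-full∖ : ∀ {m} (j : Fin (suc m)) → removeAt (const true ∖ j) j ≗ const true
removeAt-full∖ j c = cong not (dec-false (punchIn j c ≟ j) (punchInᵢ≢i j c))

-- The determinant over GF(2) of the rows R restricted to the columns in S, expanded along the
-- first row; S keeps track of the columns not yet used, and characteristic 2 makes signs irrelevant.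
detOn : ∀ {k m} → (Fin m → Bool) → Vector (Fin m → Bool) k → Bool
detOn {zero}      S R = true
detOn {suc k} {m} S R = ∑[ j < m ] (S j ∧ (R 0F j ∧ detOn (S ∖ j) (tail R)))

removeColumn : ∀ {k m} → Vector (Fin (suc m) → Bool) k → Fin (suc m) → Vector (Fin m → Bool) k
removeColumn R j = map (λ row → removeAt row j) R

detOn-cong : ∀ {k m} {S S′ : Fin m → Bool} (R : Vector (Fin m → Bool) k) → S ≗ S′ → detOn S R ≡ detOn S′ R
detOn-cong {zero}  R S≗S′ = refl
detOn-cong {suc k} R S≗S′ = sum-cong-≗ λ j →
  cong₂ (λ s d → s ∧ (R 0F j ∧ d)) (S≗S′ j) (detOn-cong (tail R) (λ c → cong (_∧ _) (S≗S′ c)))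

detOn-removeAt : ∀ {k m} (S : Fin (suc m) → Bool) (R : Vector (Fin (suc m) → Bool) k) j → S j ≡ false →
                 detOn S R ≡ detOn (removeAt S j) (removeColumn R j)
detOn-removeAt {zero}      S R j Sj≡false = refl
detOn-removeAt {suc k} {m} S R j Sj≡false = begin
  sum term                                   ≡⟨ sum-remove term ⟩
  term j xor ∑[ c < m ] term (punchIn j c)
    ≡⟨ cong₂ _xor_ (cong (_∧ (R 0F j ∧ detOn (S ∖ j) (tail R))) Sj≡false)
                   (sum-cong-≗ λ c → cong (λ d → S (punchIn j c) ∧ (R 0F (punchIn j c) ∧ d)) (minor-removeAt c)) ⟩
  detOn (removeAt S j) (removeColumn R j) ∎
  where
  open ≡-Reasoning
  term : Fin (suc m) → Bool
  term c = S c ∧ (R 0F c ∧ detOn (S ∖ c) (tail R))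
  minor-removeAt : ∀ c → detOn (S ∖ punchIn j c) (tail R)
                       ≡ detOn (removeAt S j ∖ c) (removeColumn (tail R) j)
  minor-removeAt c = trans (detOn-removeAt (S ∖ punchIn j c) (tail R) j (cong (_∧ _) Sj≡false))
                           (detOn-cong (removeColumn (tail R) j) (removeAt-∖ S j c))

det-≡₂ : ∀ {k} {A : Matrix k} {B : Vector (Fin k → Bool) k} → (∀ r c → A r c ≡₂ B r c) →
         det A ≡₂ detOn (const true) B
det-≡₂ {zero}          _      = by-quotient (+ 0) refl
det-≡₂ {suc k} {A} {B} A≡₂B = subst (det A ≡₂_) (sum-cong-≗ expansion)
  (sumℤ-≡₂ λ j → sign-≡₂ j (*-≡₂ (A≡₂B 0F j) (det-≡₂ λ r c → A≡₂B (suc r) (punchIn j c))))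
  where
  expansion : ∀ j → B 0F j ∧ detOn (const true) (removeColumn (tail B) j)
                  ≡ B 0F j ∧ detOn (const true ∖ j) (tail B)
  expansion j = cong (B 0F j ∧_) (sym (trans (detOn-removeAt (const true ∖ j) (tail B) j (∖-self _ j))
                                             (detOn-cong (removeColumn (tail B) j) (removeAt-full∖ j))))

cofactor : ∀ {k m} → (Fin m → Bool) → Vector (Fin m → Bool) k → Fin k → Fin m → Bool
cofactor         S R zero    j = S j ∧ detOn (S ∖ j) (tail R)
cofactor {m = m} S R (suc i) j = ∑[ a < m ] (S a ∧ (R 0F a ∧ cofactor (S ∖ a) (tail R) i j))

detOn-expand-row : ∀ {k m} S (R : Vector (Fin m → Bool) k) i →
                   detOn S R ≡ ∑[ j < m ] (R i j ∧ cofactor S R i j)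
detOn-expand-row S R zero = sum-cong-≗ λ j → x∙yz≈y∙xz (S j) (R 0F j) (detOn (S ∖ j) (tail R))
detOn-expand-row {m = m} S R (suc i) = begin
  ∑[ a < m ] (S a ∧ (R 0F a ∧ detOn (S ∖ a) (tail R)))
    ≡⟨ sum-cong-≗ (λ a → cong (λ d → S a ∧ (R 0F a ∧ d)) (detOn-expand-row (S ∖ a) (tail R) i)) ⟩
  ∑[ a < m ] (S a ∧ (R 0F a ∧ ∑[ j < m ] (R (suc i) j ∧ C a j)))
    ≡⟨ sum-cong-≗ (λ a → trans (∧∧-distrib-sum (S a) (R 0F a) (λ j → R (suc i) j ∧ C a j))
                               (sum-cong-≗ λ j → interchange (S a) (R 0F a) (R (suc i) j) (C a j))) ⟩
  ∑[ a < m ] ∑[ j < m ] (R (suc i) j ∧ (S a ∧ (R 0F a ∧ C a j)))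
    ≡⟨ ∑-comm (λ a j → R (suc i) j ∧ (S a ∧ (R 0F a ∧ C a j))) ⟩
  ∑[ j < m ] ∑[ a < m ] (R (suc i) j ∧ (S a ∧ (R 0F a ∧ C a j)))
    ≡⟨ sum-cong-≗ (λ j → sym (*-distribˡ-sum (R (suc i) j) (λ a → S a ∧ (R 0F a ∧ C a j)))) ⟩
  ∑[ j < m ] (R (suc i) j ∧ cofactor S R (suc i) j) ∎
  where
  open ≡-Reasoning
  C : Fin m → Fin m → Bool
  C a = cofactor (S ∖ a) (tail R) i
  interchange : ∀ s x y c → s ∧ (x ∧ (y ∧ c)) ≡ y ∧ (s ∧ (x ∧ c))
  interchange = solve 4 (λ s x y c → s · (x · (y · c)) ⊜ y · (s · (x · c))) refl

cofactor-updateAt : ∀ {k m} S (R : Vector (Fin m → Bool) k) i f → cofactor S (updateAt R i f) i ≗ cofactor S R i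
cofactor-updateAt S R zero    f j = refl
cofactor-updateAt S R (suc i) f j = sum-cong-≗ λ a →
  cong (λ c → S a ∧ (R 0F a ∧ c)) (cofactor-updateAt (S ∖ a) (tail R) i f j)

detOn-zero-tail : ∀ {k m} S (R : Vector (Fin m → Bool) (suc k)) → (∀ S′ → detOn S′ (tail R) ≡ false) →
                  detOn S R ≡ false
detOn-zero-tail S R tail≡false = sum-zero λ j → begin
  S j ∧ (R 0F j ∧ detOn (S ∖ j) (tail R)) ≡⟨ cong (λ d → S j ∧ (R 0F j ∧ d)) (tail≡false (S ∖ j)) ⟩
  S j ∧ (R 0F j ∧ false)                  ≡⟨ cong (S j ∧_) (∧-zeroʳ (R 0F j)) ⟩
  S j ∧ false                             ≡⟨ ∧-zeroʳ (S j) ⟩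
  false                                   ∎
  where open ≡-Reasoning

pairTerm : ∀ {k m} → (Fin m → Bool) → Vector (Fin m → Bool) (suc (suc k)) → Fin m → Fin m → Bool
pairTerm S R a b = S a ∧ (R 0F a ∧ ((S ∖ a) b ∧ (R 1F b ∧ detOn (S ∖ a ∖ b) (tail (tail R)))))

detOn-expand-pair : ∀ {k m} S (R : Vector (Fin m → Bool) (suc (suc k))) →
                    detOn S R ≡ ∑[ a < m ] ∑[ b < m ] pairTerm S R a b
detOn-expand-pair S R = sum-cong-≗ λ a →
  ∧∧-distrib-sum (S a) (R 0F a) (λ b → (S ∖ a) b ∧ (R 1F b ∧ detOn (S ∖ a ∖ b) (tail (tail R))))

pairTerm-swap : ∀ {k m} S (R : Vector (Fin m → Bool) (suc (suc k))) a b →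
                pairTerm S (R 1F ◂ R 0F ◂ tail (tail R)) a b ≡ pairTerm S R b a
pairTerm-swap {k} {m} S R a b = begin
  S a ∧ (R 1F a ∧ ((S b ∧ not (does (b ≟ a))) ∧ (R 0F b ∧ detOn (S ∖ a ∖ b) rest)))
    ≡⟨ cong₂ (λ e d → S a ∧ (R 1F a ∧ ((S b ∧ not e) ∧ (R 0F b ∧ d))))
             (does-⇔ (mk⇔ sym sym) (b ≟ a) (a ≟ b)) (detOn-cong rest (∖-comm S a b)) ⟩
  S a ∧ (R 1F a ∧ ((S b ∧ not (does (a ≟ b))) ∧ (R 0F b ∧ detOn (S ∖ b ∖ a) rest)))
    ≡⟨ interchange (S a) (R 1F a) (S b) (not (does (a ≟ b))) (R 0F b) (detOn (S ∖ b ∖ a) rest) ⟩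
  pairTerm S R b a ∎
  where
  open ≡-Reasoning
  rest : Vector (Fin m → Bool) k
  rest = tail (tail R)
  interchange : ∀ sa x sb n y d → sa ∧ (x ∧ ((sb ∧ n) ∧ (y ∧ d))) ≡ sb ∧ (y ∧ ((sa ∧ n) ∧ (x ∧ d)))
  interchange = solve 6 (λ sa x sb n y d → sa · (x · ((sb · n) · (y · d))) ⊜ sb · (y · ((sa · n) · (x · d)))) refl

-- No sign change: we are in characteristic 2.
detOn-swap01 : ∀ {k m} S (R : Vector (Fin m → Bool) (suc (suc k))) →
               detOn S (R 1F ◂ R 0F ◂ tail (tail R)) ≡ detOn S R
detOn-swap01 {k} {m} S R = begin
  detOn S R′                                    ≡⟨ detOn-expand-pair S R′ ⟩
  ∑[ a < m ] ∑[ b < m ] pairTerm S R′ a b        ≡⟨ sum-cong-≗ (λ a → sum-cong-≗ (pairTerm-swap S R a)) ⟩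
  ∑[ a < m ] ∑[ b < m ] pairTerm S R b a         ≡⟨ ∑-comm (λ a b → pairTerm S R b a) ⟩
  ∑[ b < m ] ∑[ a < m ] pairTerm S R b a         ≡⟨ detOn-expand-pair S R ⟨
  detOn S R                                     ∎
  where
  open ≡-Reasoning
  R′ : Vector (Fin m → Bool) (suc (suc k))
  R′ = R 1F ◂ R 0F ◂ tail (tail R)

detOn-equal01 : ∀ {k m} S (R : Vector (Fin m → Bool) (suc (suc k))) → R 0F ≗ R 1F → detOn S R ≡ false
detOn-equal01 S R R₀≗R₁ =
  trans (detOn-expand-pair S R) (∑∑-symmetric-hollow (pairTerm S R) pairTerm-sym pairTerm-diag)
  where
  pairTerm-sym : ∀ a b → pairTerm S R a b ≡ pairTerm S R b a
  pairTerm-sym a b = trans (cong₂ (λ x y → S a ∧ (x ∧ ((S ∖ a) b ∧ (y ∧ detOn (S ∖ a ∖ b) (tail (tail R))))))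
                                  (R₀≗R₁ a) (sym (R₀≗R₁ b)))
                           (pairTerm-swap S R a b)
  pairTerm-diag : ∀ a → pairTerm S R a a ≡ false
  pairTerm-diag a = trans (cong (λ s → S a ∧ (R 0F a ∧ (s ∧ (R 1F a ∧ detOn (S ∖ a ∖ a) (tail (tail R))))))
                                (∖-self S a))
                          (trans (cong (S a ∧_) (∧-zeroʳ (R 0F a))) (∧-zeroʳ (S a)))

detOn-equal-rows : ∀ {k m} S (R : Vector (Fin m → Bool) k) {r s} → r ≢ s → R r ≗ R s → detOn S R ≡ false
detOn-equal-row₀ : ∀ {k m} S (R : Vector (Fin m → Bool) (suc k)) s → R 0F ≗ R (suc s) → detOn S R ≡ false

detOn-equal-rows S R {zero}  {zero}  r≢s _      = contradiction refl r≢s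
detOn-equal-rows S R {zero}  {suc s} _   Rr≗Rs = detOn-equal-row₀ S R s Rr≗Rs
detOn-equal-rows S R {suc r} {zero}  _   Rr≗Rs = detOn-equal-row₀ S R r (sym ∘ Rr≗Rs)
detOn-equal-rows S R {suc r} {suc s} r≢s Rr≗Rs =
  detOn-zero-tail S R λ S′ → detOn-equal-rows S′ (tail R) (r≢s ∘ cong suc) Rr≗Rs

detOn-equal-row₀ S R zero    R₀≗R₁ = detOn-equal01 S R R₀≗R₁
detOn-equal-row₀ {k} {m} S R (suc s) R₀≗Rₛ = begin
  detOn S R   ≡⟨ detOn-swap01 S R ⟨
  detOn S R′  ≡⟨ detOn-zero-tail S R′ (λ S′ → detOn-equal-row₀ S′ (tail R′) s R₀≗Rₛ) ⟩
  false       ∎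
  where
  open ≡-Reasoning
  R′ : Vector (Fin m → Bool) (suc k)
  R′ = R 1F ◂ R 0F ◂ tail (tail R)

-- withRow t is the determinant of R with row i replaced by R t (Laplace expansion along row i);
-- it vanishes for t ≢ i by alternation, so the relation ∑ v t R t = 0 yields v i ∧ detOn S R = 0.
detOn-singular : ∀ {k m} S (R : Vector (Fin m → Bool) k) (v : Fin k → Bool) i → v i ≡ true →
                 (∀ c → ∑[ t < k ] (v t ∧ R t c) ≡ false) → detOn S R ≡ false
detOn-singular {k} {m} S R v i vᵢ≡true vR≡0 = begin
  detOn S R                                    ≡⟨ cong (_∧ detOn S R) vᵢ≡true ⟨
  v i ∧ detOn S R                              ≡⟨ cong (v i ∧_) (detOn-expand-row S R i) ⟩
  v i ∧ withRow i                              ≡⟨ sum-onlyAt i other-terms ⟨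
  ∑[ t < k ] (v t ∧ withRow t)                 ≡⟨ sum-cong-≗ (λ t → *-distribˡ-sum (v t) (λ j → R t j ∧ C j)) ⟩
  ∑[ t < k ] ∑[ j < m ] (v t ∧ (R t j ∧ C j))  ≡⟨ ∑-comm (λ t j → v t ∧ (R t j ∧ C j)) ⟩
  ∑[ j < m ] ∑[ t < k ] (v t ∧ (R t j ∧ C j))  ≡⟨ sum-cong-≗ (λ j → sum-cong-≗ λ t → ∧-assoc (v t) (R t j) (C j)) ⟨
  ∑[ j < m ] ∑[ t < k ] ((v t ∧ R t j) ∧ C j)  ≡⟨ sum-cong-≗ (λ j → *-distribʳ-sum (C j) (λ t → v t ∧ R t j)) ⟨
  ∑[ j < m ] (∑[ t < k ] (v t ∧ R t j) ∧ C j)  ≡⟨ sum-zero (λ j → cong (_∧ C j) (vR≡0 j)) ⟩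
  false                                        ∎
  where
  open ≡-Reasoning
  C : Fin m → Bool
  C = cofactor S R i
  withRow : Fin k → Bool
  withRow t = ∑[ j < m ] (R t j ∧ C j)
  withRow-other : ∀ t → t ≢ i → withRow t ≡ false
  withRow-other t t≢i = begin
    withRow t
      ≡⟨ sum-cong-≗ (λ j → cong₂ _∧_ (cong (λ row → row j) (updateAt-updates i R))
                                     (cofactor-updateAt S R i (const (R t)) j)) ⟨
    ∑[ j < m ] (R′ i j ∧ cofactor S R′ i j)
      ≡⟨ detOn-expand-row S R′ i ⟨
    detOn S R′
      ≡⟨ detOn-equal-rows S R′ (t≢i ∘ sym) (λ c → cong (λ row → row c) R′ᵢ≡R′ₜ) ⟩
    false
      ∎
    where
    R′ : Vector (Fin m → Bool) k
    R′ = updateAt R i (const (R t))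
    R′ᵢ≡R′ₜ : R′ i ≡ R′ t
    R′ᵢ≡R′ₜ = trans (updateAt-updates i R) (sym (updateAt-minimal t i R t≢i))
  other-terms : ∀ t → t ≢ i → v t ∧ withRow t ≡ false
  other-terms t t≢i = trans (cong (v t ∧_) (withRow-other t t≢i)) (∧-zeroʳ (v t))

lookup-sumV : ∀ {n m} (f : Fin m → ℤ₂^ n) k → lookup (sumV f) k ≡ ∑[ y < m ] lookup (f y) k
lookup-sumV {m = zero}  f k = lookup-replicate k false
lookup-sumV {m = suc m} f k = trans (lookup-zipWith _xor_ k (f 0F) (sumV (f ∘ suc)))
                                    (cong (lookup (f 0F) k xor_) (lookup-sumV (f ∘ suc) k))

lookup-if : ∀ {n} b (u : ℤ₂^ n) k → lookup (if b then u else zeroV) k ≡ b ∧ lookup u k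
lookup-if true  u k = refl
lookup-if false u k = lookup-replicate k false

lookup-neighbourSum : ∀ {m n} (G : SimpleGraph m) (ℓ : Fin m → ℤ₂^ n) x k →
                      lookup (neighbourSum G ℓ x) k ≡ ∑[ y < m ] (adj G x y ∧ lookup (ℓ y) k)
lookup-neighbourSum G ℓ x k = trans (lookup-sumV (λ y → if adj G x y then ℓ y else zeroV) k)
                                    (sum-cong-≗ λ y → lookup-if (adj G x y) (ℓ y) k)

labeling⇒kernelVector : ∀ {n} {G : SimpleGraph (2 ^ n)} → OpenXORMagicLabeling n G →
                   Σ[ v ∈ (Fin (2 ^ n) → Bool) ] Σ[ i ∈ Fin (2 ^ n) ]
                     v i ≡ true × (∀ c → ∑[ t < 2 ^ n ] (v t ∧ adj G t c) ≡ false)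
-- For n = 0 the labeling carries no information: the single vertex has no loop, so A(G) = 0.
labeling⇒kernelVector {zero}  {G} _ = const true , 0F , refl , λ { zero → cong (_xor false) (loopless G 0F) }
labeling⇒kernelVector {suc n} {G} L = v , i , cong (λ u → lookup u 0F) ℓᵢ≡e₀ , vA≡0
  where
  open OpenXORMagicLabeling L
  ℓ : Fin (2 ^ suc n) → ℤ₂^ (suc n)
  ℓ = Bijection.to bij
  v : Fin (2 ^ suc n) → Bool
  v y = lookup (ℓ y) 0F
  e₀ : ℤ₂^ (suc n)
  e₀ = true ∷ replicate n false
  i : Fin (2 ^ suc n)
  i = proj₁ (Bijection.strictlySurjective bij e₀)
  ℓᵢ≡e₀ : ℓ i ≡ e₀
  ℓᵢ≡e₀ = proj₂ (Bijection.strictlySurjective bij e₀)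
  vA≡0 : ∀ c → ∑[ t < 2 ^ suc n ] (v t ∧ adj G t c) ≡ false
  vA≡0 c = begin
    ∑[ t < 2 ^ suc n ] (v t ∧ adj G t c) ≡⟨ sum-cong-≗ (λ t → trans (∧-comm (v t) (adj G t c))
                                                                    (cong (_∧ v t) (symmetric G t c))) ⟩
    ∑[ t < 2 ^ suc n ] (adj G c t ∧ v t) ≡⟨ lookup-neighbourSum G ℓ c 0F ⟨
    lookup (neighbourSum G ℓ c) 0F        ≡⟨ cong (λ u → lookup u 0F) (magic c) ⟩
    false                                 ∎
    where open ≡-Reasoning

theorem3 : (n : ℕ) (G : SimpleGraph (2 ^ n)) → OpenXORMagicLabeling n G →
    + 2 ∣ det (adjMatrix G)
theorem3 n G L with labeling⇒kernelVector L
... | v , i , vᵢ≡true , vA≡0 = ≡₂-false⇒2∣ (subst (det (adjMatrix G) ≡₂_)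
        (detOn-singular (const true) (adj G) v i vᵢ≡true vA≡0)
        (det-≡₂ λ r c → if-≡₂ (adj G r c)))
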